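{- Let $a,b,n$ be nonnegative integers and $1\le u_1<\dots<u_n\le b+2n$ integers. The region $V_{a,b,n,(u_i)_1^n}$ has a lozenge tiling if and only if $2i\le u_i$ for all $i\in\{1,\dots,n\}$.
   Context: Work on the triangular lattice of the plane with some lattice lines horizontal; its unit equilateral triangles are called triangles. A lozenge is the union of two triangles sharing an edge; a lozenge tiling of a region (a union of triangles) is a covering of it by lozenges contained in it with pairwise disjoint interiors. $H_{a,b,c,t}$ is the equiangular hexagonal region with side lengths $a,b+t,c,a+t,b,c+t$ read clockwise from the northern (horizontal) side. For $1\le u_1<\dots<u_m\le b+t$ and $1\le v_1<\dots<v_k\le c+t$, $H_{a,b,c,t,(u_i)_1^m,(v_j)_1^k}$ is obtained from $H_{a,b,c,t}$ by removing the $u_i$-th triangle along the northeast side (counting from the north the triangles sharing an edge with that side) for each $i$, and the $v_j$-th triangle along the northwest side (counted likewise) for each $j$. For nonnegative integers $a,b,n$ and $1\le u_1<\dots<u_n\le b+2n$, the region $H_{2a,b,b,2n,(u_i)_1^n,(u_i)_1^n}$ is symmetric about a vertical line $L$, and $V_{a,b,n,(u_i)_1^n}$ denotes the region consisting of the triangles of this hexagon whose interiors lie strictly west of $L$. -}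

module Defs where

open import Data.Nat using (ℕ)
open import Data.Integer using (ℤ; +_; _+_; _-_; _*_; _≤_)
open import Data.Fin using (Fin)
open import Data.Product using (_×_; Σ; ∃)
open import Data.Sum using (_⊎_)
open import Data.List using (List)
open import Data.List.Relation.Unary.All using (All)
open import Data.List.Relation.Unary.Any using (Any)
open import Data.List.Relation.Unary.AllPairs using (AllPairs)
open import Relation.Binary.PropositionalEquality using (_≡_)
open import Relation.Nullary using (¬_)

-- Lattice point (i , j) ∈ ℤ² sits at the plane point
--   i·(1,0) + j·(1/2, √3/2),
-- so horizontal lattice lines are j = const.  Unit triangles:
--   U i j : up-pointing,   vertices (i,j), (i+1,j), (i,j+1)
--   D i j : down-pointing, vertices (i+1,j), (i,j+1), (i+1,j+1)
data Triangle : Set where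
  U D : ℤ → ℤ → Triangle

Region : Set₁
Region = Triangle → Set

-- A lozenge is the union of two triangles sharing an edge.  Every such
-- pair consists of an up triangle U i j and one of its three neighbours:
--   D i j (across its slanted NE edge), D (i-1) j (across its slanted NW
--   edge), D i (j-1) (across its horizontal south edge).
data Dir : Set where
  ne nw s : Dir

record Lozenge : Set where
  constructor loz
  field
    ui uj : ℤ
    dir   : Dir

upTri : Lozenge → Triangle
upTri (loz i j _) = U i j

downTri : Lozenge → Triangle
downTri (loz i j ne) = D i j
downTri (loz i j nw) = D (i - + 1) j
downTri (loz i j s)  = D i (j - + 1)

_∈L_ : Triangle → Lozenge → Set
t ∈L l = t ≡ upTri l ⊎ t ≡ downTri l

IsLozengeTiling : Region → List Lozenge → Set
IsLozengeTiling R ls =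
  All (λ l → R (upTri l) × R (downTri l)) ls
  × AllPairs (λ l l' → ∀ t → t ∈L l → ¬ (t ∈L l')) ls
  × (∀ t → R t → Any (t ∈L_) ls)

HasLozengeTiling : Region → Set
HasLozengeTiling R = Σ (List Lozenge) (IsLozengeTiling R)

-- The hexagon H_{a,b,c,t}: sides a, b+t, c, a+t, b, c+t clockwise from the
-- north side.  Placed with vertices (0,H), (a,H), (a+b+t, c), (a+b+t, 0),
-- (b, 0), (0, b) where H = b+c+t; i.e. the convex region
--   0 ≤ j ≤ H,  0 ≤ i ≤ a+b+t,  b ≤ i+j ≤ a+b+c+t.
-- A triangle belongs to it iff all its vertices do.
InHex : ℕ → ℕ → ℕ → ℕ → Region
InHex a b c t (U i j) =
  (+ 0 ≤ j) × (j + + 1 ≤ + (b Data.Nat.+ c Data.Nat.+ t))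
  × (+ 0 ≤ i) × (i + + 1 ≤ + (a Data.Nat.+ b Data.Nat.+ t))
  × (+ b ≤ i + j) × (i + j + + 1 ≤ + (a Data.Nat.+ b Data.Nat.+ c Data.Nat.+ t))
InHex a b c t (D i j) =
  (+ 0 ≤ j) × (j + + 1 ≤ + (b Data.Nat.+ c Data.Nat.+ t))
  × (+ 0 ≤ i) × (i + + 1 ≤ + (a Data.Nat.+ b Data.Nat.+ t))
  × (+ b ≤ i + j + + 1) × (i + j + + 2 ≤ + (a Data.Nat.+ b Data.Nat.+ c Data.Nat.+ t))

-- The u-th triangle (counted from the north) along the northeast side
-- (the line i+j = a+H, H = b+c+t), 1 ≤ u ≤ b+t:  U (a+u-1) (H-u).
NETri : ℕ → ℕ → ℕ → ℕ → ℕ → Triangle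
NETri a b c t u = U (+ a + + u - + 1) (+ (b Data.Nat.+ c Data.Nat.+ t) - + u)

-- The v-th triangle (counted from the north) along the northwest side
-- (the line i = 0), 1 ≤ v ≤ c+t:  U 0 (H-v).
NWTri : ℕ → ℕ → ℕ → ℕ → ℕ → Triangle
NWTri a b c t v = U (+ 0) (+ (b Data.Nat.+ c Data.Nat.+ t) - + v)

HexRemoved : (a b c t : ℕ) {m k : ℕ} → (Fin m → ℕ) → (Fin k → ℕ) → Region
HexRemoved a b c t {m} {k} us vs tr =
  InHex a b c t tr
  × (∀ (i : Fin m) → ¬ (tr ≡ NETri a b c t (us i)))
  × (∀ (j : Fin k) → ¬ (tr ≡ NWTri a b c t (vs j)))

-- Twice the maximal x-coordinate of a triangle (x of (i,j) is i + j/2).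
twiceMaxX : Triangle → ℤ
twiceMaxX (U i j) = + 2 * i + j + + 2
twiceMaxX (D i j) = + 2 * i + j + + 3

-- V_{a,b,n,(u_i)}: triangles of H_{2a,b,b,2n,(u_i),(u_i)} whose interiors
-- lie strictly west of the symmetry axis L : x = a+b+n.
V : (a b n : ℕ) → (Fin n → ℕ) → Region
V a b n us tr =
  HexRemoved (2 Data.Nat.* a) b b (2 Data.Nat.* n) us us tr
  × (twiceMaxX tr ≤ + (2 Data.Nat.* (a Data.Nat.+ b Data.Nat.+ n)))

module Submission where

-- V is a stack of H = 2b + 2n horizontal rows, each made of an interval [lo↑ j, hi↑ j) of up
-- triangles and an interval [lo↓ j, hi↓ j) of down triangles.  In a tiling every up triangle
-- below row J shares its lozenge with a distinct down triangle below row J; counting both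
-- kinds of triangles row by row turns this into the inequality T J ≤ hi↑ J for an explicit
-- function T.  Conversely, if all these inequalities hold, pairing each up triangle at a
-- position ≥ T j of its row with the down triangle below it, and all others horizontally,
-- tiles V.  Writing k = H ∸ J, the inequality says that at most ⌊ k/2 ⌋ of the u_i are ≤ k,
-- and this holds for all k exactly when 2i ≤ u_i for all i.

open import Defs
open import Data.Nat
  using (ℕ; zero; suc; _+_; _*_; _∸_; _≤_; _<_; z≤n; s≤s; s≤s⁻¹; _≤?_; _<?_; _≟_; ⌊_/2⌋; ⌈_/2⌉)
open import Data.Nat.Properties
open import Data.Nat.Tactic.RingSolver using (solve)
open import Data.Integer as ℤ using (ℤ; +_; -[1+_])
import Data.Integer.Properties as ℤ
open import Data.Fin.Properties
  using (toℕ-injective) renaming (suc-injective to fsuc-injective; 0≢1+n to fzero≢fsuc)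
open import Data.Fin using (Fin; toℕ) renaming (zero to fzero; suc to fsuc)
open import Data.Product using (_×_; _,_; proj₁; proj₂; ∃)
import Data.Product as Product
open import Data.Sum using (_⊎_; inj₁; inj₂; [_,_]; [_,_]′)
open import Data.Empty using (⊥; ⊥-elim)
open import Data.List using (List; []; _∷_; _++_; length; map; applyUpTo)
open import Data.List.Properties using (length-++; length-applyUpTo)
open import Data.List.Relation.Unary.All as All using (All)
import Data.List.Relation.Unary.All.Properties as AllP
import Data.List.Relation.Unary.Any.Properties as AnyP
open import Data.List.Relation.Unary.Any using (Any; here; there)
open import Data.List.Relation.Unary.AllPairs as AllPairs using (AllPairs)
import Data.List.Relation.Unary.AllPairs.Properties as AllPairsP
open import Data.List.Relation.Unary.Unique.Propositional using (Unique)
import Data.List.Relation.Unary.Unique.Propositional.Properties as Unique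
open import Data.List.Membership.Propositional using (_∈_; find; lose)
open import Data.List.Membership.Propositional.Properties
  using (∈-++⁺ˡ; ∈-++⁺ʳ; ∈-++⁻; ∈-applyUpTo⁺; ∈-applyUpTo⁻)
open import Function using (_∘_; _⇔_; mk⇔; Equivalence)
open import Function.Properties.Equivalence using () renaming (trans to ⇔-trans)
open import Relation.Binary.PropositionalEquality hiding ([_])
open import Relation.Nullary using (¬_; yes; no; contradiction)
open import Relation.Binary using (tri<; tri≈; tri>)
open import Relation.Unary using (Decidable)
open import Algebra.Properties.CommutativeSemigroup +-commutativeSemigroup
  using () renaming (interchange to +-interchange)

⌊m+m+n/2⌋≡m+⌊n/2⌋ : ∀ m n → ⌊ m + m + n /2⌋ ≡ m + ⌊ n /2⌋
⌊m+m+n/2⌋≡m+⌊n/2⌋ zero    n = refl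
⌊m+m+n/2⌋≡m+⌊n/2⌋ (suc m) n rewrite +-suc m m = cong suc (⌊m+m+n/2⌋≡m+⌊n/2⌋ m n)

m≤o+⌊n/2⌋⇔m+m≤o+o+n : ∀ {m} o n → m ≤ o + ⌊ n /2⌋ ⇔ m + m ≤ o + o + n
m≤o+⌊n/2⌋⇔m+m≤o+o+n {m} o n = mk⇔ to from
  where
  open ≤-Reasoning
  to : m ≤ o + ⌊ n /2⌋ → m + m ≤ o + o + n
  to m≤ = begin
    m + m                          ≤⟨ +-mono-≤ m≤ m≤ ⟩
    o + ⌊ n /2⌋ + (o + ⌊ n /2⌋)    ≡⟨ +-interchange o ⌊ n /2⌋ o ⌊ n /2⌋ ⟩
    o + o + (⌊ n /2⌋ + ⌊ n /2⌋)    ≤⟨ +-monoʳ-≤ (o + o) (+-monoʳ-≤ ⌊ n /2⌋ (⌊n/2⌋≤⌈n/2⌉ n)) ⟩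
    o + o + (⌊ n /2⌋ + ⌈ n /2⌉)    ≡⟨ cong (λ x → o + o + x) (⌊n/2⌋+⌈n/2⌉≡n n) ⟩
    o + o + n                      ∎
  from : m + m ≤ o + o + n → m ≤ o + ⌊ n /2⌋
  from m+m≤ = begin
    m                    ≡⟨ n≡⌊n+n/2⌋ m ⟩
    ⌊ m + m /2⌋          ≤⟨ ⌊n/2⌋-mono m+m≤ ⟩
    ⌊ o + o + n /2⌋      ≡⟨ ⌊m+m+n/2⌋≡m+⌊n/2⌋ o n ⟩
    o + ⌊ n /2⌋          ∎

m∸n≡1+[m∸1+n] : ∀ {m n} → n < m → m ∸ n ≡ suc (m ∸ suc n)
m∸n≡1+[m∸1+n] {suc m} {zero}  _         = refl
m∸n≡1+[m∸1+n] {suc m} {suc n} (s≤s n<m) = m∸n≡1+[m∸1+n] n<m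

m∸n≤o⇔m≤o+n : ∀ {m n o} → m ∸ n ≤ o ⇔ m ≤ o + n
m∸n≤o⇔m≤o+n {m} {n} {o} = mk⇔
  (λ m∸n≤o → ≤-trans (m≤n+m∸n m n) (subst (n + (m ∸ n) ≤_) (+-comm n o) (+-monoʳ-≤ n m∸n≤o)))
  (λ m≤o+n → m≤n+o⇒m∸n≤o m n (≤-trans m≤o+n (≤-reflexive (+-comm o n))))

+m-+n≡+[m∸n] : ∀ {m n} → n ≤ m → + m ℤ.- + n ≡ + (m ∸ n)
+m-+n≡+[m∸n] {m} {n} n≤m = trans (ℤ.m-n≡m⊖n m n) (ℤ.⊖-≥ n≤m)

count : ∀ {n} {P : Fin n → Set} → Decidable P → ℕ
count {zero}  P? = 0
count {suc n} P? with P? fzero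
... | yes _ = suc (count (P? ∘ fsuc))
... | no  _ = count (P? ∘ fsuc)

count-none : ∀ {n} {P : Fin n → Set} (P? : Decidable P) → (∀ l → ¬ P l) → count P? ≡ 0
count-none {zero}  P? ¬P = refl
count-none {suc n} P? ¬P with P? fzero
... | yes p = contradiction p (¬P fzero)
... | no  _ = count-none (P? ∘ fsuc) (¬P ∘ fsuc)

count-all : ∀ {n} {P : Fin n → Set} (P? : Decidable P) → (∀ l → P l) → count P? ≡ n
count-all {zero}  P? allP = refl
count-all {suc n} P? allP with P? fzero
... | yes _  = cong suc (count-all (P? ∘ fsuc) (allP ∘ fsuc))
... | no ¬p = contradiction (allP fzero) ¬p

count-mono : ∀ {n} {P Q : Fin n → Set} (P? : Decidable P) (Q? : Decidable Q) →
             (∀ l → P l → Q l) → count P? ≤ count Q?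
count-mono {zero}  P? Q? P⇒Q = z≤n
count-mono {suc n} P? Q? P⇒Q with P? fzero | Q? fzero
... | yes _ | yes _ = s≤s (count-mono (P? ∘ fsuc) (Q? ∘ fsuc) (P⇒Q ∘ fsuc))
... | yes p | no ¬q = contradiction (P⇒Q fzero p) ¬q
... | no  _ | yes _ = m≤n⇒m≤1+n (count-mono (P? ∘ fsuc) (Q? ∘ fsuc) (P⇒Q ∘ fsuc))
... | no  _ | no  _ = count-mono (P? ∘ fsuc) (Q? ∘ fsuc) (P⇒Q ∘ fsuc)

count-pos : ∀ {n} {P : Fin n → Set} (P? : Decidable P) {l} → P l → 0 < count P?
count-pos {suc n} P? {l} pl with P? fzero
... | yes _ = s≤s z≤n
count-pos {suc n} P? {fzero}  pl | no ¬p = contradiction pl ¬p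
count-pos {suc n} P? {fsuc l} pl | no _  = count-pos (P? ∘ fsuc) pl

count-pos⇒∃ : ∀ {n} {P : Fin n → Set} (P? : Decidable P) → 0 < count P? → ∃ P
count-pos⇒∃ {suc n} P? pos with P? fzero
... | yes p = fzero , p
... | no  _ = Product.map fsuc (λ p → p) (count-pos⇒∃ (P? ∘ fsuc) pos)

count-≤1 : ∀ {n} {P : Fin n → Set} (P? : Decidable P) →
           (∀ {l l′} → P l → P l′ → l ≡ l′) → count P? ≤ 1
count-≤1 {zero}  P? unique = z≤n
count-≤1 {suc n} P? unique with P? fzero
... | yes p = s≤s (≤-reflexive (count-none (P? ∘ fsuc) (λ l pl → fzero≢fsuc (unique p pl))))
... | no  _ = count-≤1 (P? ∘ fsuc) (λ p p′ → fsuc-injective (unique p p′))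

count-split : ∀ {n} {P Q R : Fin n → Set} (P? : Decidable P) (Q? : Decidable Q) (R? : Decidable R) →
              (∀ l → P l ⇔ (Q l ⊎ R l)) → (∀ l → Q l → ¬ R l) →
              count P? ≡ count Q? + count R?
count-split {zero}  P? Q? R? P⇔Q⊎R disjoint = refl
count-split {suc n} P? Q? R? P⇔Q⊎R disjoint
  with P? fzero | Q? fzero | R? fzero
     | count-split (P? ∘ fsuc) (Q? ∘ fsuc) (R? ∘ fsuc) (P⇔Q⊎R ∘ fsuc) (disjoint ∘ fsuc)
... | _     | yes q | yes r | _    = contradiction r (disjoint fzero q)
... | yes _ | yes _ | no  _ | rest = cong suc rest
... | yes _ | no  _ | yes _ | rest = trans (cong suc rest) (sym (+-suc _ _))
... | yes p | no ¬q | no ¬r | _    = contradiction (Equivalence.to (P⇔Q⊎R fzero) p) [ ¬q , ¬r ]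
... | no ¬p | yes q | _     | _    = contradiction (Equivalence.from (P⇔Q⊎R fzero) (inj₁ q)) ¬p
... | no ¬p | no  _ | yes r | _    = contradiction (Equivalence.from (P⇔Q⊎R fzero) (inj₂ r)) ¬p
... | no  _ | no  _ | no  _ | rest = rest

count-≤-of-bounded : ∀ {n m} {P : Fin n → Set} (P? : Decidable P) →
                     (∀ l → P l → toℕ l < m) → count P? ≤ m
count-≤-of-bounded {zero}  P? bounded = z≤n
count-≤-of-bounded {suc n} P? bounded with P? fzero
count-≤-of-bounded {suc n} {suc m} P? bounded | yes _ =
  s≤s (count-≤-of-bounded (P? ∘ fsuc) (λ l pl → s≤s⁻¹ (bounded (fsuc l) pl)))
count-≤-of-bounded {suc n} {zero} P? bounded | yes p = contradiction (bounded fzero p) λ ()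
... | no _ = count-≤-of-bounded (P? ∘ fsuc) (λ l pl → <⇒≤ (bounded (fsuc l) pl))

count-≥-of-prefix : ∀ {n} {P : Fin n → Set} (P? : Decidable P) (i : Fin n) →
                    (∀ l → toℕ l ≤ toℕ i → P l) → suc (toℕ i) ≤ count P?
count-≥-of-prefix {suc n} P? i prefix with P? fzero
... | no ¬p = contradiction (prefix fzero z≤n) ¬p
count-≥-of-prefix {suc n} P? fzero    prefix | yes _ = s≤s z≤n
count-≥-of-prefix {suc n} P? (fsuc i) prefix | yes _ =
  s≤s (count-≥-of-prefix (P? ∘ fsuc) i (λ l l≤i → prefix (fsuc l) (s≤s l≤i)))

∈-remove : ∀ {B : Set} {y : B} {ys} → y ∈ ys →
           ∃ λ ys′ → length ys ≡ suc (length ys′) ×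
                     (∀ {w} → w ∈ ys → w ≢ y → w ∈ ys′)
∈-remove {ys = _ ∷ ys} (here refl) = ys , refl , λ
  { (here refl) w≢y → contradiction refl w≢y
  ; (there w∈)  _   → w∈
  }
∈-remove {ys = z ∷ _}  (there y∈) with ∈-remove y∈
... | ys′ , len , keep = z ∷ ys′ , cong suc len , λ
  { (here refl) _   → here refl
  ; (there w∈)  w≢y → there (keep w∈ w≢y)
  }

length-≤-of-injective-relation :
  ∀ {A B : Set} {R : A → B → Set} {xs : List A} {ys : List B} →
  Unique xs →
  (∀ {x} → x ∈ xs → ∃ λ y → y ∈ ys × R x y) →
  (∀ {x x′ y} → R x y → R x′ y → x ≡ x′) →
  length xs ≤ length ys
length-≤-of-injective-relation {xs = []} _ _ _ = z≤n
length-≤-of-injective-relation {R = R} {xs = x ∷ xs} {ys} (x∉xs AllPairs.∷ unique) related injective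
  with related (here refl)
... | y , y∈ys , Rxy with ∈-remove y∈ys
...   | ys′ , len , keep = subst (suc (length xs) ≤_) (sym len)
        (s≤s (length-≤-of-injective-relation unique relatedʳ injective))
  where
  relatedʳ : ∀ {x′} → x′ ∈ xs → ∃ λ y′ → y′ ∈ ys′ × R x′ y′
  relatedʳ x′∈ with related (there x′∈)
  ... | y′ , y′∈ys , Rx′y′ =
    y′ , keep y′∈ys (λ { refl → All.lookup x∉xs x′∈ (injective Rxy Rx′y′) }) , Rx′y′

unique⇒allPairs : ∀ {A : Set} {S : A → A → Set} {xs : List A} → Unique xs →
                  (∀ {x y} → x ∈ xs → y ∈ xs → x ≢ y → S x y) → AllPairs S xs
unique⇒allPairs {xs = []} _ _ = AllPairs.[]
unique⇒allPairs {xs = x ∷ xs} (x∉xs AllPairs.∷ unique) S-distinct =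
  All.tabulate (λ y∈ → S-distinct (here refl) (there y∈) (All.lookup x∉xs y∈))
  AllPairs.∷ unique⇒allPairs unique (λ p q → S-distinct (there p) (there q))

DisjointLozenges : Lozenge → Lozenge → Set
DisjointLozenges l l′ = ∀ t → t ∈L l → ¬ (t ∈L l′)

covering-unique : ∀ {ls l l′ t} → AllPairs DisjointLozenges ls → l ∈ ls → l′ ∈ ls →
                  t ∈L l → t ∈L l′ → l ≡ l′
covering-unique (_ AllPairs.∷ _)  (here refl) (here refl) _   _    = refl
covering-unique (d AllPairs.∷ _)  (here refl) (there q)   t∈l t∈l′ = ⊥-elim (All.lookup d q _ t∈l t∈l′)
covering-unique (d AllPairs.∷ _)  (there p)   (here refl) t∈l t∈l′ = ⊥-elim (All.lookup d p _ t∈l′ t∈l)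
covering-unique (_ AllPairs.∷ ds) (there p)   (there q)   t∈l t∈l′ = covering-unique ds p q t∈l t∈l′

U≢downTri : ∀ {x y} l → U x y ≢ downTri l
U≢downTri (loz _ _ ne) ()
U≢downTri (loz _ _ nw) ()
U≢downTri (loz _ _ s)  ()

U∈L⇒≡upTri : ∀ {x y} l → U x y ∈L l → U x y ≡ upTri l
U∈L⇒≡upTri l = [ (λ e → e) , ⊥-elim ∘ U≢downTri l ]

tiling-cong : ∀ {R S : Region} → (∀ t → R t ⇔ S t) → HasLozengeTiling R ⇔ HasLozengeTiling S
tiling-cong R⇔S =
  mk⇔ (transport (Equivalence.to (R⇔S _)) (Equivalence.from (R⇔S _)))
      (transport (Equivalence.from (R⇔S _)) (Equivalence.to (R⇔S _)))
  where
  transport : ∀ {R S : Region} → (∀ {t} → R t → S t) → (∀ {t} → S t → R t) →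
              HasLozengeTiling R → HasLozengeTiling S
  transport R⇒S S⇒R (ls , inside , disjoint , cover) =
    ls , All.map (Product.map R⇒S R⇒S) inside , disjoint , λ t → cover t ∘ S⇒R

triangleRow : Triangle → ℤ
triangleRow (U _ y) = y
triangleRow (D _ y) = y

downRow≤upRow : ∀ l {i j i′ j′} → upTri l ≡ U (+ i) (+ j) → downTri l ≡ D (+ i′) (+ j′) →
                j′ ≤ j
downRow≤upRow (loz _ _ ne) refl e = ≤-reflexive (ℤ.+-injective (sym (cong triangleRow e)))
downRow≤upRow (loz _ _ nw) refl e = ≤-reflexive (ℤ.+-injective (sym (cong triangleRow e)))
downRow≤upRow (loz _ _ s) {j = zero} refl e with cong triangleRow e
... | ()
downRow≤upRow (loz _ _ s) {j = suc j} refl e =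
  m≤n⇒m≤1+n (≤-reflexive (ℤ.+-injective (sym (cong triangleRow e))))

-- Regions made of rows

Cell : Set
Cell = ℕ × ℕ

upTriangle downTriangle : Cell → Triangle
upTriangle   (i , j) = U (+ i) (+ j)
downTriangle (i , j) = D (+ i) (+ j)

upTriangle-injective : ∀ {c c′} → upTriangle c ≡ upTriangle c′ → c ≡ c′
upTriangle-injective {_ , _} {_ , _} refl = refl

downTriangle-injective : ∀ {c c′} → downTriangle c ≡ downTriangle c′ → c ≡ c′
downTriangle-injective {_ , _} {_ , _} refl = refl

InRows : ℕ → (lo hi : ℕ → ℕ) → Cell → Set
InRows J lo hi (i , j) = j < J × lo j ≤ i × i < hi j

row : (lo hi : ℕ → ℕ) → ℕ → List Cell
row lo hi j = applyUpTo (λ k → lo j + k , j) (hi j ∸ lo j)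

cellsBelow : (lo hi : ℕ → ℕ) → ℕ → List Cell
cellsBelow lo hi zero    = []
cellsBelow lo hi (suc J) = row lo hi J ++ cellsBelow lo hi J

module _ (lo hi : ℕ → ℕ) where

  ∈row⇔ : ∀ {i j j′} → (i , j′) ∈ row lo hi j ⇔ (j′ ≡ j × lo j ≤ i × i < hi j)
  ∈row⇔ {i} {j} = mk⇔ to from
    where
    to : ∀ {j′} → (i , j′) ∈ row lo hi j → j′ ≡ j × lo j ≤ i × i < hi j
    to i∈ with ∈-applyUpTo⁻ (λ k → lo j + k , j) i∈
    ... | k , k<hi∸lo , refl = refl , m≤m+n (lo j) k , subst (_< hi j) (+-comm k (lo j)) k+lo<hi
      where k+lo<hi = m≤o∸n⇒m+n≤o (suc k) (<⇒≤ (m∸n≢0⇒n<m (m<n⇒n≢0 k<hi∸lo))) k<hi∸lo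
    from : ∀ {j′} → j′ ≡ j × lo j ≤ i × i < hi j → (i , j′) ∈ row lo hi j
    from (refl , lo≤i , i<hi) =
      subst (λ x → (x , j) ∈ row lo hi j) (m+[n∸m]≡n lo≤i)
            (∈-applyUpTo⁺ (λ k → lo j + k , j) (∸-monoˡ-< i<hi lo≤i))

  ∈cellsBelow⇔ : ∀ {i j} J → (i , j) ∈ cellsBelow lo hi J ⇔ InRows J lo hi (i , j)
  ∈cellsBelow⇔ {i} {j} J = mk⇔ (to J) (from J)
    where
    to : ∀ J → (i , j) ∈ cellsBelow lo hi J → InRows J lo hi (i , j)
    to (suc J) c∈ with ∈-++⁻ (row lo hi J) c∈
    ... | inj₁ c∈row with Equivalence.to ∈row⇔ c∈row
    ...   | refl , lo≤i , i<hi = ≤-refl , lo≤i , i<hi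
    to (suc J) c∈ | inj₂ c∈below = Product.map m<n⇒m<1+n (λ p → p) (to J c∈below)
    from : ∀ J → InRows J lo hi (i , j) → (i , j) ∈ cellsBelow lo hi J
    from (suc J) (j<1+J , lo≤i , i<hi) with m≤n⇒m<n∨m≡n (s≤s⁻¹ j<1+J)
    ... | inj₂ refl = ∈-++⁺ˡ (Equivalence.from ∈row⇔ (refl , lo≤i , i<hi))
    ... | inj₁ j<J  = ∈-++⁺ʳ (row lo hi J) (from J (j<J , lo≤i , i<hi))

  length-cellsBelow : ∀ J → length (cellsBelow lo hi (suc J)) ≡ (hi J ∸ lo J) + length (cellsBelow lo hi J)
  length-cellsBelow J = trans (length-++ (row lo hi J))
                              (cong (_+ length (cellsBelow lo hi J)) (length-applyUpTo _ (hi J ∸ lo J)))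

  cellsBelow-unique : ∀ J → Unique (cellsBelow lo hi J)
  cellsBelow-unique zero    = AllPairs.[]
  cellsBelow-unique (suc J) =
    Unique.++⁺ (Unique.applyUpTo⁺₁ _ (hi J ∸ lo J) distinct) (cellsBelow-unique J) disjoint
    where
    distinct : ∀ {k k′} → k < k′ → k′ < hi J ∸ lo J → (lo J + k , J) ≢ (lo J + k′ , J)
    distinct k<k′ _ e = <-irrefl (+-cancelˡ-≡ (lo J) _ _ (cong proj₁ e)) k<k′
    disjoint : ∀ {c} → c ∈ row lo hi J × c ∈ cellsBelow lo hi J → ⊥
    disjoint {_ , _} (c∈row , c∈below) with Equivalence.to ∈row⇔ c∈row
    ... | refl , _ = <-irrefl refl (proj₁ (Equivalence.to (∈cellsBelow⇔ J) c∈below))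

SharedLozenge : List Lozenge → Cell → Cell → Set
SharedLozenge ls c d = ∃ λ l → l ∈ ls × upTriangle c ∈L l × downTriangle d ∈L l

sharedLozenge-injective : ∀ {ls c c′ d} → AllPairs DisjointLozenges ls →
                          SharedLozenge ls c d → SharedLozenge ls c′ d → c ≡ c′
sharedLozenge-injective {c = _ , _} {c′ = _ , _} disjoint
  (l , l∈ , c∈l , d∈l) (l′ , l′∈ , c′∈l′ , d∈l′) with covering-unique disjoint l∈ l′∈ d∈l d∈l′
... | refl = upTriangle-injective (trans (U∈L⇒≡upTri l c∈l) (sym (U∈L⇒≡upTri l c′∈l′)))

balance-step : ∀ x y d u t t′ l↑ l↓ {h↑ h↓} →
               x + l↓ ≡ h↓ → h↑ ≤ l↑ + y → t + l↓ ≡ t′ + l↑ → d + t ≤ u + h↑ →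
               x + d + t′ ≤ y + u + h↓
balance-step x y d u t t′ l↑ l↓ {h↑} {h↓} x+l↓≡h↓ h↑≤l↑+y balanced d+t≤u+h↑ =
  +-cancelʳ-≤ l↑ _ _ (begin
    x + d + t′ + l↑      ≡⟨ +-assoc (x + d) t′ l↑ ⟩
    x + d + (t′ + l↑)    ≡⟨ cong (λ z → x + d + z) (sym balanced) ⟩
    x + d + (t + l↓)     ≡⟨ solve (x ∷ d ∷ t ∷ l↓ ∷ []) ⟩
    x + l↓ + (d + t)     ≡⟨ cong (λ z → z + (d + t)) x+l↓≡h↓ ⟩
    h↓ + (d + t)         ≤⟨ +-monoʳ-≤ h↓ (≤-trans d+t≤u+h↑ (+-monoʳ-≤ u h↑≤l↑+y)) ⟩
    h↓ + (u + (l↑ + y))  ≡⟨ solve (h↓ ∷ u ∷ l↑ ∷ y ∷ []) ⟩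
    y + u + h↓ + l↑      ∎)
  where open ≤-Reasoning

module LozengeRows (H : ℕ) (lo↑ hi↑ lo↓ hi↓ : ℕ → ℕ) where

  UpCell DownCell : Cell → Set
  UpCell   = InRows H lo↑ hi↑
  DownCell = InRows H lo↓ hi↓

  RowRegion : Region
  RowRegion (U (+ i) (+ j)) = UpCell (i , j)
  RowRegion (D (+ i) (+ j)) = DownCell (i , j)
  RowRegion _               = ⊥

  RowRegion-D⇒cell : ∀ x y → RowRegion (D x y) → ∃ λ d → D x y ≡ downTriangle d × DownCell d
  RowRegion-D⇒cell (+ i)     (+ j)     down = (i , j) , refl , down
  RowRegion-D⇒cell (+ _)     -[1+ _ ] ()
  RowRegion-D⇒cell -[1+ _ ] _         ()

  RowRegion-downTri⇒cell : ∀ l → RowRegion (downTri l) → ∃ λ d → downTri l ≡ downTriangle d × DownCell d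
  RowRegion-downTri⇒cell (loz x y ne) = RowRegion-D⇒cell x y
  RowRegion-downTri⇒cell (loz x y nw) = RowRegion-D⇒cell (x ℤ.- + 1) y
  RowRegion-downTri⇒cell (loz x y s)  = RowRegion-D⇒cell x (y ℤ.- + 1)

  data RowStep (T : ℕ → ℕ) (j : ℕ) : Set where
    level   : T j ≡ T (suc j)       → lo↑ j ≡ lo↓ j       → RowStep T j
    shifted : T j ≡ suc (T (suc j)) → lo↑ j ≡ suc (lo↓ j) → RowStep T j

  -- The up triangles of row j at positions ≥ T j go with the down triangles below them; the
  -- remaining up triangles [lo↑ j, T j) and down triangles [lo↓ j, T (suc j)) of row j are
  -- paired horizontally, so these stretches must have equal length and be offset by ≤ 1.
  record Balanced (T : ℕ → ℕ) : Set where
    field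
      T-bottom    : T 0 ≡ hi↑ 0
      T-top       : T H ≡ hi↑ H
      hi↓≡hi↑-suc : ∀ {j} → j < H → hi↓ j ≡ hi↑ (suc j)
      balance     : ∀ {j} → j < H → T j + lo↓ j ≡ T (suc j) + lo↑ j
      lo-shift    : ∀ {j} → j < H → lo↑ j ≡ lo↓ j ⊎ lo↑ j ≡ suc (lo↓ j)
      lo↑≤T       : ∀ {j} → j < H → lo↑ j ≤ T j
      lo↓≤hi↓     : ∀ {j} → j < H → lo↓ j ≤ hi↓ j

  module _ {T : ℕ → ℕ} (balanced : Balanced T) where
    open Balanced balanced

    rowStep : ∀ {j} → j < H → RowStep T j
    rowStep {j} j<H with lo-shift j<H
    ... | inj₁ e = level (+-cancelʳ-≡ (lo↓ j) _ _ (trans (balance j<H) (cong (λ z → T (suc j) + z) e))) e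
    ... | inj₂ e = shifted (+-cancelʳ-≡ (lo↓ j) _ _ (trans (balance j<H)
                     (trans (cong (λ z → T (suc j) + z) e) (+-suc (T (suc j)) (lo↓ j))))) e

    lo↓≤T-suc : ∀ {j} → j < H → lo↓ j ≤ T (suc j)
    lo↓≤T-suc j<H with rowStep j<H
    ... | level   e e′ = subst₂ _≤_ e′ e (lo↑≤T j<H)
    ... | shifted e e′ = s≤s⁻¹ (subst₂ _≤_ e′ e (lo↑≤T j<H))

    cells-balance : ∀ {J} → J ≤ H →
                    length (cellsBelow lo↓ hi↓ J) + T J ≤ length (cellsBelow lo↑ hi↑ J) + hi↑ J
    cells-balance {zero}  _    = ≤-reflexive T-bottom
    cells-balance {suc J} J<H  =
      subst₂ (λ x y → x + T (suc J) ≤ y + hi↑ (suc J))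
             (sym (length-cellsBelow lo↓ hi↓ J)) (sym (length-cellsBelow lo↑ hi↑ J))
             (balance-step (hi↓ J ∸ lo↓ J) (hi↑ J ∸ lo↑ J) (length downs) (length ups)
                           (T J) (T (suc J)) (lo↑ J) (lo↓ J)
                           (trans (m∸n+n≡m (lo↓≤hi↓ J<H)) (hi↓≡hi↑-suc J<H)) (m≤n+m∸n (hi↑ J) (lo↑ J))
                           (balance J<H) (cells-balance (<⇒≤ J<H)))
      where
      ups   = cellsBelow lo↑ hi↑ J
      downs = cellsBelow lo↓ hi↓ J

    upCell-shares : ∀ {ls J c} → IsLozengeTiling RowRegion ls → J ≤ H →
                    c ∈ cellsBelow lo↑ hi↑ J → ∃ λ d → d ∈ cellsBelow lo↓ hi↓ J × SharedLozenge ls c d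
    upCell-shares {J = J} {i , j} (inside , _ , cover) J≤H c∈
      with Equivalence.to (∈cellsBelow⇔ lo↑ hi↑ J) c∈
    ... | j<J , lo≤i , i<hi with find (cover (upTriangle (i , j)) (<-≤-trans j<J J≤H , lo≤i , i<hi))
    ...   | l , l∈ls , c∈l with RowRegion-downTri⇒cell l (proj₂ (All.lookup inside l∈ls))
    ...     | (i′ , j′) , e , _ , lo≤i′ , i′<hi =
      (i′ , j′) ,
      Equivalence.from (∈cellsBelow⇔ lo↓ hi↓ J)
        (≤-<-trans (downRow≤upRow l (sym (U∈L⇒≡upTri l c∈l)) e) j<J , lo≤i′ , i′<hi) ,
      l , l∈ls , c∈l , inj₂ (sym e)

    tiling⇒T≤hi↑ : HasLozengeTiling RowRegion → ∀ {J} → J ≤ H → T J ≤ hi↑ J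
    tiling⇒T≤hi↑ (ls , tiling) {J} J≤H = +-cancelˡ-≤ (length downs) _ _ (begin
      length downs + T J    ≤⟨ cells-balance J≤H ⟩
      length ups + hi↑ J    ≤⟨ +-monoˡ-≤ (hi↑ J) ups≤downs ⟩
      length downs + hi↑ J  ∎)
      where
      open ≤-Reasoning
      ups = cellsBelow lo↑ hi↑ J
      downs = cellsBelow lo↓ hi↓ J
      ups≤downs : length ups ≤ length downs
      ups≤downs = length-≤-of-injective-relation (cellsBelow-unique lo↑ hi↑ J)
                    (upCell-shares tiling J≤H) (sharedLozenge-injective (proj₁ (proj₂ tiling)))

    data Match : Cell → Cell → Set where
      vertical : ∀ {i j} → T (suc j) ≤ i → Match (i , suc j) (i , j)
      level    : ∀ {i j} → i < T j → T j ≡ T (suc j) → lo↑ j ≡ lo↓ j → Match (i , j) (i , j)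
      shifted  : ∀ {i j} → suc i < T j → T j ≡ suc (T (suc j)) → lo↑ j ≡ suc (lo↓ j) →
                 Match (suc i , j) (i , j)

    direction : Cell → Dir
    direction (i , j) with T j ≤? i | lo↑ j ≟ lo↓ j
    ... | yes _ | _     = s
    ... | no  _ | yes _ = ne
    ... | no  _ | no  _ = nw

    lozengeAt : Cell → Lozenge
    lozengeAt c = loz (+ proj₁ c) (+ proj₂ c) (direction c)

    downTri-match : ∀ {c d} → Match c d → downTri (lozengeAt c) ≡ downTriangle d
    downTri-match (vertical {i} {j} T≤i) with T (suc j) ≤? i
    ... | yes _   = refl
    ... | no  T≰i = contradiction T≤i T≰i
    downTri-match (level {i} {j} i<T _ e) with T j ≤? i | lo↑ j ≟ lo↓ j
    ... | yes T≤i | _     = contradiction T≤i (<⇒≱ i<T)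
    ... | no  _   | yes _ = refl
    ... | no  _   | no ¬e = contradiction e ¬e
    downTri-match (shifted {i} {j} i<T _ e) with T j ≤? suc i | lo↑ j ≟ lo↓ j
    ... | yes T≤i | _      = contradiction T≤i (<⇒≱ i<T)
    ... | no  _   | yes e′ = contradiction (trans (sym e) e′) 1+n≢n
    ... | no  _   | no  _  = refl

    vertical≢level : ∀ {i j} → T (suc j) ≤ i → i < T j → T j ≡ T (suc j) → ⊥
    vertical≢level T≤i i<T e = <⇒≱ (subst (_ <_) e i<T) T≤i

    vertical≢shifted : ∀ {i j} → T (suc j) ≤ i → suc i < T j → T j ≡ suc (T (suc j)) → ⊥
    vertical≢shifted T≤i i<T e = <⇒≱ (s≤s⁻¹ (subst (_ <_) e i<T)) T≤i

    match-injective : ∀ {c c′ d} → Match c d → Match c′ d → c ≡ c′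
    match-injective (vertical _)      (vertical _)      = refl
    match-injective (level _ _ _)     (level _ _ _)     = refl
    match-injective (shifted _ _ _)   (shifted _ _ _)   = refl
    match-injective (vertical T≤i)    (level i<T e _)   = ⊥-elim (vertical≢level T≤i i<T e)
    match-injective (level i<T e _)   (vertical T≤i)    = ⊥-elim (vertical≢level T≤i i<T e)
    match-injective (vertical T≤i)    (shifted i<T e _) = ⊥-elim (vertical≢shifted T≤i i<T e)
    match-injective (shifted i<T e _) (vertical T≤i)    = ⊥-elim (vertical≢shifted T≤i i<T e)
    match-injective (level _ _ e)     (shifted _ _ e′)  = ⊥-elim (1+n≢n (trans (sym e′) e))
    match-injective (shifted _ _ e′)  (level _ _ e)     = ⊥-elim (1+n≢n (trans (sym e′) e))


    module _ (T≤hi↑ : ∀ {j} → j ≤ H → T j ≤ hi↑ j) where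

      T-suc≤hi↓ : ∀ {j} → j < H → T (suc j) ≤ hi↓ j
      T-suc≤hi↓ j<H = subst (_ ≤_) (sym (hi↓≡hi↑-suc j<H)) (T≤hi↑ j<H)

      up-match : ∀ {c} → UpCell c → ∃ λ d → DownCell d × Match c d
      up-match {i , j} (j<H , lo≤i , i<hi) with T j ≤? i
      up-match {i , zero} (_ , _ , i<hi) | yes T≤i =
        contradiction (subst (_≤ i) T-bottom T≤i) (<⇒≱ i<hi)
      up-match {i , suc j} (1+j<H , _ , i<hi) | yes T≤i =
        (i , j) , (j<H , ≤-trans (lo↓≤T-suc j<H) T≤i , subst (i <_) (sym (hi↓≡hi↑-suc j<H)) i<hi) ,
        vertical T≤i
        where j<H = <-trans (n<1+n j) 1+j<H
      ... | no T≰i with rowStep j<H | ≰⇒> T≰i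
      ...   | level e e′   | i<T =
        (i , j) , (j<H , subst (_≤ i) e′ lo≤i , <-≤-trans (subst (i <_) e i<T) (T-suc≤hi↓ j<H)) ,
        level i<T e e′
      ...   | shifted e e′ | i<T with subst (_≤ i) e′ lo≤i
      ...     | s≤s lo↓≤i′ =
        (_ , j) , (j<H , lo↓≤i′ , ≤-trans (s≤s⁻¹ (subst (_ <_) e i<T)) (T-suc≤hi↓ j<H)) ,
        shifted i<T e e′

      down-match : ∀ {d} → DownCell d → ∃ λ c → UpCell c × Match c d
      down-match {i , j} (j<H , lo≤i , i<hi) with T (suc j) ≤? i
      ... | yes T≤i =
        (i , suc j) , (1+j<H , ≤-trans (lo↑≤T 1+j<H) T≤i , subst (i <_) (hi↓≡hi↑-suc j<H) i<hi) ,
        vertical T≤i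
        where
        1+j<H : suc j < H
        1+j<H with m≤n⇒m<n∨m≡n j<H
        ... | inj₁ 1+j<H = 1+j<H
        ... | inj₂ refl  = contradiction (subst (_≤ i) (trans T-top (sym (hi↓≡hi↑-suc j<H))) T≤i)
                                         (<⇒≱ i<hi)
      ... | no T≰i with rowStep j<H | ≰⇒> T≰i
      ...   | level e e′   | i<T =
        (i , j) , (j<H , subst (_≤ i) (sym e′) lo≤i , <-≤-trans i<Tj (T≤hi↑ (<⇒≤ j<H))) ,
        level i<Tj e e′
        where i<Tj = subst (i <_) (sym e) i<T
      ...   | shifted e e′ | i<T =
        (suc i , j) , (j<H , subst (_≤ suc i) (sym e′) (s≤s lo≤i) , <-≤-trans 1+i<Tj (T≤hi↑ (<⇒≤ j<H))) ,
        shifted 1+i<Tj e e′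
        where 1+i<Tj = subst (suc i <_) (sym e) (s≤s i<T)

      rowTiling : IsLozengeTiling RowRegion (map lozengeAt (cellsBelow lo↑ hi↑ H))
      rowTiling =
        AllP.map⁺ (All.tabulate inside) ,
        AllPairsP.map⁺ (unique⇒allPairs (cellsBelow-unique lo↑ hi↑ H) disjoint) ,
        cover
        where
        upCell⇔ : ∀ {i j} → (i , j) ∈ cellsBelow lo↑ hi↑ H ⇔ UpCell (i , j)
        upCell⇔ = ∈cellsBelow⇔ lo↑ hi↑ H

        upCell : ∀ {c} → c ∈ cellsBelow lo↑ hi↑ H → UpCell c
        upCell {_ , _} = Equivalence.to upCell⇔

        inside : ∀ {c} → c ∈ cellsBelow lo↑ hi↑ H →
                 RowRegion (upTri (lozengeAt c)) × RowRegion (downTri (lozengeAt c))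
        inside {_ , _} c∈ with up-match (upCell c∈)
        ... | (_ , _) , down , m = upCell c∈ , subst RowRegion (sym (downTri-match m)) down

        disjoint : ∀ {c c′} → c ∈ cellsBelow lo↑ hi↑ H → c′ ∈ cellsBelow lo↑ hi↑ H → c ≢ c′ →
                   DisjointLozenges (lozengeAt c) (lozengeAt c′)
        disjoint {_ , _} {_ , _} _ _ c≢c′ t (inj₁ e) (inj₁ e′) =
          c≢c′ (upTriangle-injective (trans (sym e) e′))
        disjoint {_} {c′} _ _ _ t (inj₁ e) (inj₂ e′) = U≢downTri (lozengeAt c′) (trans (sym e) e′)
        disjoint {c} {_}  _ _ _ t (inj₂ e) (inj₁ e′) = U≢downTri (lozengeAt c) (trans (sym e′) e)
        disjoint c∈ c′∈ c≢c′ t (inj₂ e) (inj₂ e′)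
          with up-match (upCell c∈) | up-match (upCell c′∈)
        ... | d , _ , m | d′ , _ , m′
          with downTriangle-injective
                 (trans (sym (downTri-match m)) (trans (sym e) (trans e′ (downTri-match m′))))
        ...   | refl = c≢c′ (match-injective m m′)

        cover : ∀ t → RowRegion t → Any (t ∈L_) (map lozengeAt (cellsBelow lo↑ hi↑ H))
        cover (U (+ i) (+ j)) up = AnyP.map⁺ (lose (Equivalence.from upCell⇔ up) (inj₁ refl))
        cover (D (+ i) (+ j)) down with down-match down
        ... | (_ , _) , up , m =
          AnyP.map⁺ (lose (Equivalence.from upCell⇔ up) (inj₂ (sym (downTri-match m))))
        cover (U (+ _) -[1+ _ ]) ()
        cover (U -[1+ _ ] _)     ()
        cover (D (+ _) -[1+ _ ]) ()
        cover (D -[1+ _ ] _)     ()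

  tileable⇔ : ∀ {T} → Balanced T → HasLozengeTiling RowRegion ⇔ (∀ {j} → j ≤ H → T j ≤ hi↑ j)
  tileable⇔ balanced = mk⇔ (tiling⇒T≤hi↑ balanced) (λ T≤hi↑ → _ , rowTiling balanced T≤hi↑)

-- The half hexagon V

module HexagonHalf (a b n : ℕ) (u : Fin n → ℕ)
                   (u≥1 : ∀ i → 1 ≤ u i)
                   (u-increasing : ∀ i j → toℕ i < toℕ j → u i < u j)
                   (u≤ : ∀ i → u i ≤ b + 2 * n) where

  H : ℕ
  H = b + b + 2 * n

  u≤? : ∀ k → Decidable (λ l → u l ≤ k)
  u≤? k l = u l ≤? k

  u≟ : ∀ k → Decidable (λ l → u l ≡ k)
  u≟ k l = u l ≟ k

  count≤ hits : ℕ → ℕ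
  count≤ k = count (u≤? k)
  hits   k = count (u≟ k)

  u-injective : ∀ {l l′} → u l ≡ u l′ → l ≡ l′
  u-injective {l} {l′} e with <-cmp (toℕ l) (toℕ l′)
  ... | tri< l<l′ _ _ = contradiction e (<⇒≢ (u-increasing l l′ l<l′))
  ... | tri≈ _ l≡l′ _ = toℕ-injective l≡l′
  ... | tri> _ _ l′<l = contradiction (sym e) (<⇒≢ (u-increasing l′ l l′<l))

  hits≡0⊎1 : ∀ k → hits k ≡ 0 ⊎ hits k ≡ 1
  hits≡0⊎1 k with hits k | count-≤1 (u≟ k) (λ e e′ → u-injective (trans e (sym e′)))
  ... | 0 | _ = inj₁ refl
  ... | 1 | _ = inj₂ refl
  ... | suc (suc _) | s≤s ()

  hits-beyond : ∀ {k} → b + 2 * n < k → hits k ≡ 0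
  hits-beyond {k} k> = count-none (u≟ k) (λ l e → <⇒≱ k> (subst (_≤ _) e (u≤ l)))

  count≤-beyond : ∀ {k} → b + 2 * n ≤ k → count≤ k ≡ n
  count≤-beyond {k} k≥ = count-all (u≤? k) (λ l → ≤-trans (u≤ l) k≥)

  count≤-zero : count≤ 0 ≡ 0
  count≤-zero = count-none (u≤? 0) (λ l → <⇒≱ (u≥1 l))

  count≤-suc : ∀ k → count≤ (suc k) ≡ count≤ k + hits (suc k)
  count≤-suc k = count-split (u≤? (suc k)) (u≤? k) (u≟ (suc k))
    (λ l → mk⇔ (λ ≤1+k → [ inj₁ ∘ s≤s⁻¹ , inj₂ ]′ (m≤n⇒m<n∨m≡n ≤1+k))
               [ m≤n⇒m≤1+n , ≤-reflexive ]′)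
    (λ l ≤k e → <⇒≱ (s≤s ≤k) (≤-reflexive (sym e)))

  hits≤count≤ : ∀ k → hits k ≤ count≤ k
  hits≤count≤ k = count-mono (u≟ k) (u≤? k) (λ l → ≤-reflexive)

  -- Row j of V lies between heights j and j + 1, so H ∸ j is the distance of its bottom from
  -- the north side: the removed northwest triangle u is the up triangle at position 0 of row
  -- H ∸ u, the axis L leaves a + ⌊ (H ∸ j)/2 ⌋ up triangles of row j to its west, and the
  -- removed northeast triangles lie east of L.  T is forced by T H = a and balance.
  lo↑ hi↑ lo↓ hi↓ T : ℕ → ℕ
  lo↑ j = (b ∸ j) + hits (H ∸ j)
  hi↑ j = a + ⌊ H ∸ j /2⌋
  lo↓ j = b ∸ suc j
  hi↓ j = a + ⌊ H ∸ suc j /2⌋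
  T   j = a + count≤ (H ∸ j) + (b ∸ j)

  open LozengeRows H lo↑ hi↑ lo↓ hi↓ public

  H≡b+[b+2n] : H ≡ b + (b + 2 * n)
  H≡b+[b+2n] = +-assoc b b (2 * n)

  b≤j-of-H∸j≤ : ∀ {j} → H ∸ j ≤ b + 2 * n → b ≤ j
  b≤j-of-H∸j≤ {j} H∸j≤ = +-cancelʳ-≤ (b + 2 * n) b j (begin
    b + (b + 2 * n)      ≡⟨ sym H≡b+[b+2n] ⟩
    H                    ≤⟨ Equivalence.to m∸n≤o⇔m≤o+n H∸j≤ ⟩
    b + 2 * n + j        ≡⟨ +-comm (b + 2 * n) j ⟩
    j + (b + 2 * n)      ∎)
    where open ≤-Reasoning

  H∸j-beyond : ∀ {j} → j < b → b + 2 * n < H ∸ j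
  H∸j-beyond {j} j<b = m+n≤o⇒m≤o∸n (suc (b + 2 * n)) (begin
    suc (b + 2 * n) + j  ≡⟨ cong suc (+-comm (b + 2 * n) j) ⟩
    suc j + (b + 2 * n)  ≤⟨ +-monoˡ-≤ (b + 2 * n) j<b ⟩
    b + (b + 2 * n)      ≡⟨ sym H≡b+[b+2n] ⟩
    H                    ∎)
    where open ≤-Reasoning

  H∸j-below : ∀ {j} → j ≤ b → H ∸ j ≡ (b ∸ j) + (b + 2 * n)
  H∸j-below {j} j≤b = trans (cong (_∸ j) H≡b+[b+2n]) (+-∸-comm (b + 2 * n) j≤b)

  a+n+[b∸j]≤hi↑ : ∀ {j} → j ≤ b → a + n + (b ∸ j) ≤ hi↑ j
  a+n+[b∸j]≤hi↑ {j} j≤b = Equivalence.from (m≤o+⌊n/2⌋⇔m+m≤o+o+n a (H ∸ j)) (begin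
    a + n + e + (a + n + e)        ≡⟨ rearrange e ⟩
    a + a + (e + (e + 2 * n))      ≤⟨ +-monoʳ-≤ (a + a) (+-monoʳ-≤ e (+-monoˡ-≤ (2 * n) (m∸n≤m b j))) ⟩
    a + a + (e + (b + 2 * n))      ≡⟨ cong (λ z → a + a + z) (sym (H∸j-below j≤b)) ⟩
    a + a + (H ∸ j)                ∎)
    where open ≤-Reasoning
          e = b ∸ j
          rearrange : ∀ x → a + n + x + (a + n + x) ≡ a + a + (x + (x + 2 * n))
          rearrange x = solve (a ∷ n ∷ x ∷ [])

  count≤-row : ∀ {j} → j < H → count≤ (H ∸ j) ≡ count≤ (H ∸ suc j) + hits (H ∸ j)
  count≤-row {j} j<H rewrite m∸n≡1+[m∸1+n] j<H = count≤-suc (H ∸ suc j)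

  b≤H : b ≤ H
  b≤H = ≤-trans (m≤m+n b b) (m≤m+n (b + b) (2 * n))

  b+2n≤H : b + 2 * n ≤ H
  b+2n≤H = ≤-trans (m≤n+m (b + 2 * n) b) (≤-reflexive (sym H≡b+[b+2n]))

  balanced : Balanced T
  balanced = record
    { T-bottom    = T-bottom
    ; T-top       = T-top
    ; hi↓≡hi↑-suc = λ _ → refl
    ; balance     = balance
    ; lo-shift    = lo-shift
    ; lo↑≤T       = λ {j} _ → lo↑≤T j
    ; lo↓≤hi↓     = λ {j} _ → lo↓≤hi↓ j
    }
    where
    T-bottom : T 0 ≡ hi↑ 0
    T-bottom = begin
      a + count≤ H + b        ≡⟨ cong (λ c → a + c + b) (count≤-beyond b+2n≤H) ⟩
      a + n + b               ≡⟨ solve (a ∷ n ∷ b ∷ []) ⟩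
      a + (b + n)             ≡⟨ cong (λ h → a + (b + h)) (n≡⌊n+n/2⌋ n) ⟩
      a + (b + ⌊ n + n /2⌋)   ≡⟨ cong (λ h → a + h) (sym (⌊m+m+n/2⌋≡m+⌊n/2⌋ b (n + n))) ⟩
      a + ⌊ b + b + (n + n) /2⌋ ≡⟨ cong (λ h → a + ⌊ b + b + (n + h) /2⌋) (sym (+-identityʳ n)) ⟩
      hi↑ 0                   ∎
      where open ≡-Reasoning
    T-top : T H ≡ hi↑ H
    T-top rewrite n∸n≡0 H | count≤-zero | m≤n⇒m∸n≡0 b≤H = +-identityʳ (a + 0)
    balance : ∀ {j} → j < H → T j + lo↓ j ≡ T (suc j) + lo↑ j
    balance {j} j<H = trans (cong (λ c → a + c + (b ∸ j) + (b ∸ suc j)) (count≤-row j<H))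
                            (rearrange (count≤ (H ∸ suc j)) (hits (H ∸ j)) (b ∸ j) (b ∸ suc j))
      where rearrange : ∀ c h x y → a + (c + h) + x + y ≡ a + c + y + (x + h)
            rearrange c h x y = solve (a ∷ c ∷ h ∷ x ∷ y ∷ [])
    lo-shift : ∀ {j} → j < H → lo↑ j ≡ lo↓ j ⊎ lo↑ j ≡ suc (lo↓ j)
    lo-shift {j} j<H with j <? b
    ... | yes j<b =
      inj₂ (trans (cong₂ _+_ (m∸n≡1+[m∸1+n] j<b) (hits-beyond (H∸j-beyond j<b))) (+-identityʳ _))
    ... | no  j≮b rewrite m≤n⇒m∸n≡0 (≮⇒≥ j≮b) | m≤n⇒m∸n≡0 (m≤n⇒m≤1+n (≮⇒≥ j≮b)) = hits≡0⊎1 (H ∸ j)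
    lo↑≤T : ∀ j → lo↑ j ≤ T j
    lo↑≤T j = ≤-trans (≤-reflexive (+-comm (b ∸ j) _))
                      (+-monoˡ-≤ (b ∸ j) (≤-trans (hits≤count≤ (H ∸ j)) (m≤n+m _ a)))
    lo↓≤hi↓ : ∀ j → lo↓ j ≤ hi↓ j
    lo↓≤hi↓ j with suc j ≤? b
    ... | yes 1+j≤b = ≤-trans (m≤n+m (b ∸ suc j) (a + n)) (a+n+[b∸j]≤hi↑ 1+j≤b)
    ... | no  1+j≰b rewrite m≤n⇒m∸n≡0 (<⇒≤ (≰⇒> 1+j≰b)) = z≤n

  u≤H : ∀ l → u l ≤ H
  u≤H l = ≤-trans (u≤ l) b+2n≤H

  u-monotone : ∀ {l i} → toℕ l ≤ toℕ i → u l ≤ u i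
  u-monotone {l} {i} l≤i with m≤n⇒m<n∨m≡n l≤i
  ... | inj₁ l<i = <⇒≤ (u-increasing l i l<i)
  ... | inj₂ l≡i = ≤-reflexive (cong u (toℕ-injective l≡i))

  2[x+1]≡1+x+1+x : ∀ x → 2 * (x + 1) ≡ suc x + suc x
  2[x+1]≡1+x+1+x x = solve (x ∷ [])

  Admissible : Set
  Admissible = ∀ i → 2 * (toℕ i + 1) ≤ u i

  admissible⇒count≤≤⌊/2⌋ : Admissible → ∀ k → count≤ k ≤ ⌊ k /2⌋
  admissible⇒count≤≤⌊/2⌋ admissible k = count-≤-of-bounded (u≤? k) λ l ul≤k →
    Equivalence.from (m≤o+⌊n/2⌋⇔m+m≤o+o+n 0 k)
      (≤-trans (≤-reflexive (sym (2[x+1]≡1+x+1+x (toℕ l)))) (≤-trans (admissible l) ul≤k))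

  T≤hi↑⇔admissible : (∀ {j} → j ≤ H → T j ≤ hi↑ j) ⇔ Admissible
  T≤hi↑⇔admissible = mk⇔ necessary sufficient
    where
    necessary : (∀ {j} → j ≤ H → T j ≤ hi↑ j) → Admissible
    necessary T≤hi↑ i = subst (_≤ u i) (sym (2[x+1]≡1+x+1+x (toℕ i)))
      (Equivalence.to (m≤o+⌊n/2⌋⇔m+m≤o+o+n 0 (u i)) (≤-trans i<count≤ count≤half))
      where
      i<count≤ : suc (toℕ i) ≤ count≤ (u i)
      i<count≤ = count-≥-of-prefix (u≤? (u i)) i (λ l → u-monotone)
      j = H ∸ u i
      H∸j≡ui : H ∸ j ≡ u i
      H∸j≡ui = m∸[m∸n]≡n (u≤H i)
      b∸j≡0 : b ∸ j ≡ 0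
      b∸j≡0 = m≤n⇒m∸n≡0 (b≤j-of-H∸j≤ {j} (subst (_≤ b + 2 * n) (sym H∸j≡ui) (u≤ i)))
      count≤half : count≤ (u i) ≤ ⌊ u i /2⌋
      count≤half = +-cancelˡ-≤ a _ _ (subst₂ _≤_
        (trans (cong₂ (λ k e → a + count≤ k + e) H∸j≡ui b∸j≡0) (+-identityʳ _))
        (cong (λ k → a + ⌊ k /2⌋) H∸j≡ui)
        (T≤hi↑ {j} (m∸n≤m H (u i))))
    sufficient : Admissible → ∀ {j} → j ≤ H → T j ≤ hi↑ j
    sufficient admissible {j} j≤H with j <? b
    ... | yes j<b =
      subst (_≤ hi↑ j) (cong (λ c → a + c + (b ∸ j)) (sym (count≤-beyond (<⇒≤ (H∸j-beyond j<b)))))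
            (a+n+[b∸j]≤hi↑ (<⇒≤ j<b))
    ... | no  j≮b rewrite m≤n⇒m∸n≡0 (≮⇒≥ j≮b) | +-identityʳ (a + count≤ (H ∸ j)) =
      +-monoʳ-≤ a (admissible⇒count≤≤⌊/2⌋ admissible (H ∸ j))

  twiceMaxX-U : ∀ i j → twiceMaxX (U (+ i) (+ j)) ≡ + (2 * i + j + 2)
  twiceMaxX-U i j = cong (λ z → z ℤ.+ + j ℤ.+ + 2) (sym (ℤ.pos-* 2 i))

  twiceMaxX-D : ∀ i j → twiceMaxX (D (+ i) (+ j)) ≡ + (2 * i + suc j + 2)
  twiceMaxX-D i j = trans (cong (λ z → z ℤ.+ + j ℤ.+ + 3) (sym (ℤ.pos-* 2 i)))
                          (cong +_ (solve (i ∷ j ∷ [])))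

  <hi↑⇔ : ∀ {i k} → k ≤ H → i < hi↑ k ⇔ 2 * i + k + 2 ≤ 2 * (a + b + n)
  <hi↑⇔ {i} {k} k≤H = ⇔-trans (m≤o+⌊n/2⌋⇔m+m≤o+o+n a (H ∸ k)) (mk⇔ to from)
    where
    lhs : suc i + suc i + k ≡ 2 * i + k + 2
    lhs = solve (i ∷ k ∷ [])
    rhs : a + a + (b + b + 2 * n) ≡ 2 * (a + b + n)
    rhs = solve (a ∷ b ∷ n ∷ [])
    to : suc i + suc i ≤ a + a + (H ∸ k) → 2 * i + k + 2 ≤ 2 * (a + b + n)
    to le = subst₂ _≤_ lhs rhs
      (m≤o∸n⇒m+n≤o (suc i + suc i) (≤-trans k≤H (m≤n+m H (a + a)))
                   (subst (suc i + suc i ≤_) (sym (+-∸-assoc (a + a) k≤H)) le))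
    from : 2 * i + k + 2 ≤ 2 * (a + b + n) → suc i + suc i ≤ a + a + (H ∸ k)
    from le = subst (suc i + suc i ≤_) (+-∸-assoc (a + a) k≤H)
      (m+n≤o⇒m≤o∸n (suc i + suc i) (subst₂ _≤_ (sym lhs) (sym rhs) le))

  width⇒inHex : ∀ i k → 2 * i + k + 2 ≤ 2 * (a + b + n) →
                i + 1 ≤ 2 * a + b + 2 * n × i + k + 1 ≤ 2 * a + b + b + 2 * n
  width⇒inHex i k w =
    ≤-trans (*-cancelˡ-≤ {i + 1} {a + b + n} 2 (≤-trans (≤-trans (m≤m+n _ k) (≤-reflexive e₁)) w))
            (≤-trans (m≤m+n _ (a + n)) (≤-reflexive e₂)) ,
    ≤-trans (≤-trans (m≤m+n _ (i + 1)) (≤-reflexive e₃)) (≤-trans w (≤-reflexive e₄))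
    where
    e₁ : 2 * (i + 1) + k ≡ 2 * i + k + 2
    e₁ = solve (i ∷ k ∷ [])
    e₂ : a + b + n + (a + n) ≡ 2 * a + b + 2 * n
    e₂ = solve (a ∷ b ∷ n ∷ [])
    e₃ : i + k + 1 + (i + 1) ≡ 2 * i + k + 2
    e₃ = solve (i ∷ k ∷ [])
    e₄ : 2 * (a + b + n) ≡ 2 * a + b + b + 2 * n
    e₄ = solve (a ∷ b ∷ n ∷ [])

  nwTri≡ : ∀ l → NWTri (2 * a) b b (2 * n) (u l) ≡ U (+ 0) (+ (H ∸ u l))
  nwTri≡ l = cong (U (+ 0)) (+m-+n≡+[m∸n] (u≤H l))

  1≤2a+u : ∀ l → 1 ≤ 2 * a + u l
  1≤2a+u l = ≤-trans (u≥1 l) (m≤n+m (u l) (2 * a))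

  neTri≡ : ∀ l → NETri (2 * a) b b (2 * n) (u l) ≡ U (+ (2 * a + u l ∸ 1)) (+ (H ∸ u l))
  neTri≡ l = cong₂ U (+m-+n≡+[m∸n] (1≤2a+u l)) (+m-+n≡+[m∸n] (u≤H l))

  on-nw-side : ∀ {i j l} → U (+ i) (+ j) ≡ NWTri (2 * a) b b (2 * n) (u l) → i ≡ 0 × u l ≡ H ∸ j
  on-nw-side {l = l} e with trans e (nwTri≡ l)
  ... | refl = refl , sym (m∸[m∸n]≡n (u≤H l))

  nw-side : ∀ {j l} → j ≤ H → u l ≡ H ∸ j → U (+ 0) (+ j) ≡ NWTri (2 * a) b b (2 * n) (u l)
  nw-side {j} {l} j≤H ul≡ =
    trans (cong (λ x → U (+ 0) (+ x)) (sym (trans (cong (H ∸_) ul≡) (m∸[m∸n]≡n j≤H)))) (sym (nwTri≡ l))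

  ne-outside : ∀ {i j l} → i < hi↑ j → U (+ i) (+ j) ≢ NETri (2 * a) b b (2 * n) (u l)
  ne-outside {l = l} i<hi e with trans e (neTri≡ l)
  ... | refl = <-irrefl refl (begin-strict
    a + ⌊ u l /2⌋                      <⟨ +-monoʳ-< a (⌊/2⌋< (u≥1 l)) ⟩
    a + u l                            ≤⟨ +-monoˡ-≤ (u l) (m≤m+n a (a + 0)) ⟩
    2 * a + u l                        ≡⟨ sym (trans (+-comm 1 _) (m∸n+n≡m (1≤2a+u l))) ⟩
    suc (2 * a + u l ∸ 1)              ≤⟨ i<hi ⟩
    a + ⌊ H ∸ (H ∸ u l) /2⌋            ≡⟨ cong (λ k → a + ⌊ k /2⌋) (m∸[m∸n]≡n (u≤H l)) ⟩
    a + ⌊ u l /2⌋                      ∎)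
    where open ≤-Reasoning
          ⌊/2⌋< : ∀ {m} → 0 < m → ⌊ m /2⌋ < m
          ⌊/2⌋< {suc m} _ = ⌊n/2⌋<n m

  lo↑≤⇔ : ∀ {i j} → j < H →
          lo↑ j ≤ i ⇔ (b ≤ i + j × (∀ l → U (+ i) (+ j) ≢ NWTri (2 * a) b b (2 * n) (u l)))
  lo↑≤⇔ {i} {j} j<H = mk⇔ to from
    where
    to : lo↑ j ≤ i → b ≤ i + j × (∀ l → U (+ i) (+ j) ≢ NWTri (2 * a) b b (2 * n) (u l))
    to lo≤i = Equivalence.to m∸n≤o⇔m≤o+n (≤-trans (m≤m+n (b ∸ j) _) lo≤i) , λ l e →
      let i≡0 , ul≡ = on-nw-side e
      in <-irrefl refl (<-≤-trans (≤-trans (count-pos (u≟ (H ∸ j)) ul≡) (m≤n+m _ (b ∸ j)))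
                                   (subst (lo↑ j ≤_) i≡0 lo≤i))
    from : b ≤ i + j × (∀ l → U (+ i) (+ j) ≢ NWTri (2 * a) b b (2 * n) (u l)) → lo↑ j ≤ i
    from (b≤i+j , off-nw) with hits≡0⊎1 (H ∸ j)
    ... | inj₁ h≡0 rewrite h≡0 | +-identityʳ (b ∸ j) = Equivalence.from m∸n≤o⇔m≤o+n b≤i+j
    ... | inj₂ h≡1 with count-pos⇒∃ (u≟ (H ∸ j)) (subst (0 <_) (sym h≡1) (s≤s z≤n))
    ...   | l , ul≡ rewrite h≡1 | m≤n⇒m∸n≡0 (b≤j-of-H∸j≤ {j} (subst (_≤ b + 2 * n) ul≡ (u≤ l))) =
      n≢0⇒n>0 λ { refl → off-nw l (nw-side (<⇒≤ j<H) ul≡) }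

  lo↓≤⇔ : ∀ {i j} → lo↓ j ≤ i ⇔ b ≤ i + j + 1
  lo↓≤⇔ {i} {j} = ⇔-trans m∸n≤o⇔m≤o+n (mk⇔ (subst (b ≤_) e) (subst (b ≤_) (sym e)))
    where e : i + suc j ≡ i + j + 1
          e = solve (i ∷ j ∷ [])

  V⇒RowRegion : ∀ t → V a b n u t → RowRegion t
  V⇒RowRegion (U (+ i) (+ j)) (((_ , ℤ.+≤+ j+1≤H , _ , _ , ℤ.+≤+ b≤i+j , _) , _ , off-nw) , w) =
    j<H , Equivalence.from (lo↑≤⇔ j<H) (b≤i+j , off-nw) ,
    Equivalence.from (<hi↑⇔ (<⇒≤ j<H)) (ℤ.drop‿+≤+ (subst (ℤ._≤ _) (twiceMaxX-U i j) w))
    where j<H = subst (_≤ H) (+-comm j 1) j+1≤H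
  V⇒RowRegion (D (+ i) (+ j)) (((_ , ℤ.+≤+ j+1≤H , _ , _ , ℤ.+≤+ b≤i+j+1 , _) , _) , w) =
    j<H , Equivalence.from lo↓≤⇔ b≤i+j+1 ,
    Equivalence.from (<hi↑⇔ j<H) (ℤ.drop‿+≤+ (subst (ℤ._≤ _) (twiceMaxX-D i j) w))
    where j<H = subst (_≤ H) (+-comm j 1) j+1≤H
  V⇒RowRegion (U (+ _) -[1+ _ ]) (((() , _) , _) , _)
  V⇒RowRegion (U -[1+ _ ] _)     (((_ , _ , () , _) , _) , _)
  V⇒RowRegion (D (+ _) -[1+ _ ]) (((() , _) , _) , _)
  V⇒RowRegion (D -[1+ _ ] _)     (((_ , _ , () , _) , _) , _)

  RowRegion⇒V : ∀ t → RowRegion t → V a b n u t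
  RowRegion⇒V (U (+ i) (+ j)) (j<H , lo≤i , i<hi) =
    ((ℤ.+≤+ z≤n , ℤ.+≤+ (subst (_≤ H) (+-comm 1 j) j<H) , ℤ.+≤+ z≤n , ℤ.+≤+ (proj₁ hex) ,
      ℤ.+≤+ (proj₁ left) , ℤ.+≤+ (proj₂ hex)) ,
     (λ _ → ne-outside i<hi) , proj₂ left) ,
    subst (ℤ._≤ _) (sym (twiceMaxX-U i j)) (ℤ.+≤+ w)
    where
    w = Equivalence.to (<hi↑⇔ (<⇒≤ j<H)) i<hi
    hex = width⇒inHex i j w
    left = Equivalence.to (lo↑≤⇔ j<H) lo≤i
  RowRegion⇒V (D (+ i) (+ j)) (j<H , lo≤i , i<hi) =
    ((ℤ.+≤+ z≤n , ℤ.+≤+ (subst (_≤ H) (+-comm 1 j) j<H) , ℤ.+≤+ z≤n , ℤ.+≤+ (proj₁ hex) ,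
      ℤ.+≤+ (Equivalence.to (lo↓≤⇔ {i} {j}) lo≤i) , ℤ.+≤+ (subst (_≤ 2 * a + b + b + 2 * n) e (proj₂ hex))) ,
     (λ _ ()) , (λ _ ())) ,
    subst (ℤ._≤ _) (sym (twiceMaxX-D i j)) (ℤ.+≤+ w)
    where
    w = Equivalence.to (<hi↑⇔ j<H) i<hi
    hex = width⇒inHex i (suc j) w
    e : i + suc j + 1 ≡ i + j + 2
    e = solve (i ∷ j ∷ [])

  V⇔RowRegion : ∀ t → V a b n u t ⇔ RowRegion t
  V⇔RowRegion t = mk⇔ (V⇒RowRegion t) (RowRegion⇒V t)

mainTheorem2 : (a b n : ℕ) (u : Fin n → ℕ)
    → (∀ i → 1 ≤ u i)
    → (∀ i j → toℕ i < toℕ j → u i < u j)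
    → (∀ i → u i ≤ b + 2 * n)
    → HasLozengeTiling (V a b n u) ⇔ (∀ i → 2 * (toℕ i + 1) ≤ u i)
mainTheorem2 a b n u u≥1 u-increasing u≤ =
  ⇔-trans (tiling-cong V⇔RowRegion) (⇔-trans (tileable⇔ balanced) T≤hi↑⇔admissible)
  where open HexagonHalf a b n u u≥1 u-increasing u≤
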